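{- Let $p$ be a prime and let $n\ge 2$, $k\ge 2$, $\mathfrak{a}\ge 1$ be positive integers with $2\le n\le k+1$. Then $L_n^{(k)}\neq (p+1)p^{\mathfrak{a}}-1$; i.e., the Diophantine equation $L_n^{(k)}=(p+1)p^{\mathfrak{a}}-1$ has no solution with $2\le n\le k+1$.
   Context: For an integer $k\ge 2$, the $k$-Lucas sequence $\{L_n^{(k)}\}$ is defined by $L_{2-k}^{(k)}=\cdots=L_{ -1}^{(k)}=0$, $L_0^{(k)}=2$, $L_1^{(k)}=1$, and $L_n^{(k)}=L_{n-1}^{(k)}+L_{n-2}^{(k)}+\cdots+L_{n-k}^{(k)}$ for all $n\ge 2$. -}

module Defs where

open import Data.Nat using (ℕ; zero; suc; _+_)
open import Data.List using (List; []; _∷_; take)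
open import Data.Nat.ListAction using (sum)

-- history k n = [ L_n , L_{n-1} , … , L_0 ]  (values of the k-Lucas sequence
-- with nonnegative index, most recent first).  Terms with negative index are 0,
-- so L_n = sum of the (at most k) most recent entries for n ≥ 2.
history : ℕ → ℕ → List ℕ
history k zero = 2 ∷ []
history k (suc zero) = 1 ∷ 2 ∷ []
history k (suc (suc n)) =
  let h = history k (suc n) in sum (take k h) ∷ h

head0 : List ℕ → ℕ
head0 [] = 0
head0 (x ∷ _) = x

kLucas : ℕ → ℕ → ℕ
kLucas k n = head0 (history k n)

{-# OPTIONS --safe #-}
module Submission where

-- For n ≤ k the k-Lucas recurrence still sums the whole history, so
-- L_n = L_0 + ⋯ + L_{n-1} = 3·2^(n-2); the term L_{k+1} misses only L_0 = 2,
-- so L_{k+1} = 3·2^(k-1) − 2. Hence L_n is 3 or even for 2 ≤ n ≤ k + 1,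
-- whereas (p + 1)p^a − 1 is odd, as p(p + 1) is even, and at least 5.

open import Defs
open import Data.Nat using (ℕ; _+_; _*_; _∸_; _^_; _≤_)
open import Data.Nat.Primality using (Prime)
open import Relation.Binary.PropositionalEquality using (_≢_)

open import Data.Nat using (zero; suc; _<_; z≤n; s≤s; nonTrivial⇒n>1)
open import Data.Nat.Properties
open import Data.Nat.Divisibility
open import Data.Nat.Primality using (prime⇒nonTrivial)
open import Data.Nat.ListAction using (sum)
open import Data.Nat.ListAction.Properties using (sum-++)
open import Data.List using (List; []; _∷_; _++_; take; drop; length)
open import Data.List.Properties using (take-all; take++drop≡id)
open import Data.Sum using (_⊎_; inj₁; inj₂; [_,_]′)
open import Relation.Binary.PropositionalEquality
open import Relation.Nullary using (¬_; contradiction)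
open import Data.Nat.Solver using (module +-*-Solver)
open +-*-Solver using (solve; con; _:+_; _:*_; _:=_)

length-history : ∀ k m → length (history k m) ≡ suc m
length-history k zero = refl
length-history k (suc zero) = refl
length-history k (suc (suc m)) = cong suc (length-history k (suc m))

drop-history : ∀ k m → drop m (history k m) ≡ 2 ∷ []
drop-history k zero = refl
drop-history k (suc zero) = refl
drop-history k (suc (suc m)) = drop-history k (suc m)

kLucas≡sum-history : ∀ {k} m → 2 + m ≤ k → kLucas k (2 + m) ≡ sum (history k (1 + m))
kLucas≡sum-history {k} m 2+m≤k =
  cong sum (take-all k (history k (1 + m)) (subst (_≤ k) (sym (length-history k (1 + m))) 2+m≤k))

sum-history : ∀ {k} m → m < k → sum (history k (1 + m)) ≡ 3 * 2 ^ m
sum-history zero _ = refl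
sum-history {k} (suc m) 2+m≤k = begin
  kLucas k (2 + m) + s  ≡⟨ cong (_+ s) (kLucas≡sum-history m 2+m≤k) ⟩
  s + s                 ≡⟨ cong (λ t → t + t) (sum-history m (<⇒≤ 2+m≤k)) ⟩
  3 * 2 ^ m + 3 * 2 ^ m ≡⟨ solve 1 (λ x → con 3 :* x :+ con 3 :* x := con 3 :* (con 2 :* x)) refl (2 ^ m) ⟩
  3 * 2 ^ suc m         ∎
  where
  open ≡-Reasoning
  s : ℕ
  s = sum (history k (1 + m))

kLucas[k+1]+2≡3*2^[k-1] : ∀ m → kLucas (1 + m) (2 + m) + 2 ≡ 3 * 2 ^ m
kLucas[k+1]+2≡3*2^[k-1] m = begin
  sum (take (1 + m) h) + 2                    ≡⟨ cong (λ t → sum (take (1 + m) h) + sum t) (sym (drop-history (1 + m) (1 + m))) ⟩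
  sum (take (1 + m) h) + sum (drop (1 + m) h) ≡⟨ sym (sum-++ (take (1 + m) h) (drop (1 + m) h)) ⟩
  sum (take (1 + m) h ++ drop (1 + m) h)      ≡⟨ cong sum (take++drop≡id (1 + m) h) ⟩
  sum h                                       ≡⟨ sum-history m ≤-refl ⟩
  3 * 2 ^ m                                   ∎
  where
  open ≡-Reasoning
  h : List ℕ
  h = history (1 + m) (1 + m)

kLucas≡3*2^[n-2] : ∀ {k} m → 2 + m ≤ k → kLucas k (2 + m) ≡ 3 * 2 ^ m
kLucas≡3*2^[n-2] m 2+m≤k = trans (kLucas≡sum-history m 2+m≤k) (sum-history m (<⇒≤ 2+m≤k))

2∣3*2^[1+m] : ∀ m → 2 ∣ 3 * 2 ^ suc m
2∣3*2^[1+m] m = ∣n⇒∣m*n 3 (m∣m*n (2 ^ m))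

kLucas≡3⊎2∣kLucas : ∀ {k n} → 2 ≤ k → 2 ≤ n → n ≤ k + 1 → kLucas k n ≡ 3 ⊎ 2 ∣ kLucas k n
kLucas≡3⊎2∣kLucas {n = 1} _ (s≤s ()) _
kLucas≡3⊎2∣kLucas {n = 2} 2≤k _ _ = inj₁ (kLucas≡3*2^[n-2] 0 2≤k)
kLucas≡3⊎2∣kLucas {k} {suc (suc (suc m))} _ _ n≤k+1
  with m≤n⇒m<n∨m≡n (≤-pred (subst (3 + m ≤_) (+-comm k 1) n≤k+1))
... | inj₁ 3+m≤k = inj₂ (subst (2 ∣_) (sym (kLucas≡3*2^[n-2] (1 + m) 3+m≤k)) (2∣3*2^[1+m] m))
... | inj₂ refl = inj₂ (∣m+n∣m⇒∣n 2∣2+L ∣-refl)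
  where
  2∣2+L : 2 ∣ 2 + kLucas (2 + m) (3 + m)
  2∣2+L = subst (2 ∣_) (trans (sym (kLucas[k+1]+2≡3*2^[k-1] (1 + m))) (+-comm _ 2)) (2∣3*2^[1+m] m)

2∣n⊎2∣1+n : ∀ n → 2 ∣ n ⊎ 2 ∣ 1 + n
2∣n⊎2∣1+n zero = inj₁ (2 ∣0)
2∣n⊎2∣1+n (suc n) with 2∣n⊎2∣1+n n
... | inj₁ 2∣n = inj₂ (∣m∣n⇒∣m+n ∣-refl 2∣n)
... | inj₂ 2∣1+n = inj₁ 2∣1+n

2∣[n+1]*n^[1+a] : ∀ n a → 2 ∣ (n + 1) * n ^ suc a
2∣[n+1]*n^[1+a] n a with 2∣n⊎2∣1+n n
... | inj₁ 2∣n = ∣n⇒∣m*n (n + 1) (∣m⇒∣m*n (n ^ a) 2∣n)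
... | inj₂ 2∣1+n = ∣m⇒∣m*n (n ^ suc a) (subst (2 ∣_) (+-comm 1 n) 2∣1+n)

6≤[n+1]*n^[1+a] : ∀ {n} a → 2 ≤ n → 6 ≤ (n + 1) * n ^ suc a
6≤[n+1]*n^[1+a] {n@(suc _)} a 2≤n = *-mono-≤ (+-monoˡ-≤ 1 2≤n) (*-mono-≤ 2≤n (m^n>0 n a))

2∣m⇒2∤m∸1 : ∀ {m} → 1 ≤ m → 2 ∣ m → ¬ 2 ∣ m ∸ 1
2∣m⇒2∤m∸1 {suc m} _ 2∣1+m 2∣m =
  contradiction (∣1⇒≡1 (∣m+n∣m⇒∣n (subst (2 ∣_) (+-comm 1 m) 2∣1+m) 2∣m)) λ ()

lemma5p1 : ∀ (p n k a : ℕ) → Prime p → 2 ≤ n → 2 ≤ k → 1 ≤ a → n ≤ k + 1 →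
    kLucas k n ≢ (p + 1) * p ^ a ∸ 1
lemma5p1 p n k (suc b) p-prime 2≤n 2≤k _ n≤k+1 L≡E∸1 =
  [ L≢3 , 2∤L ]′ (kLucas≡3⊎2∣kLucas 2≤k 2≤n n≤k+1)
  where
  E : ℕ
  E = (p + 1) * p ^ suc b

  6≤E : 6 ≤ E
  6≤E = 6≤[n+1]*n^[1+a] b (nonTrivial⇒n>1 p {{prime⇒nonTrivial p-prime}})

  L≢3 : kLucas k n ≢ 3
  L≢3 L≡3 = contradiction (subst (5 ≤_) (trans (sym L≡E∸1) L≡3) (∸-monoˡ-≤ 1 6≤E))
              λ { (s≤s (s≤s (s≤s ()))) }

  2∤L : ¬ 2 ∣ kLucas k n
  2∤L 2∣L = 2∣m⇒2∤m∸1 (≤-trans (s≤s z≤n) 6≤E) (2∣[n+1]*n^[1+a] p b) (subst (2 ∣_) L≡E∸1 2∣L)
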